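{- Let $G$ be an undirected graph, let $T$ be a DFS tree of $G$ rooted at the super root $r$, and let $U$ be a set of vertex and edge insertions. Then the algorithm BatchInsert described below, run on $T$ and $U$, correctly outputs (via the parent pointers $\mathit{par}^*$) a DFS tree $T^*$ of $G+U$.
   Context: $G+U$ is the graph obtained from $G$ by applying the insertions in $U$. A DFS tree of an undirected graph is a rooted spanning tree in which every non-tree edge joins an ancestor and a descendant. The root $r$ is a super root, adjacent to every vertex (including inserted vertices). Notation for the tree $T$: $T(x)$ is the subtree rooted at $x$; $\mathit{par}(x)$ is the parent of $x$; $\mathit{path}(x,y)$ is the tree path from $x$ to $y$. For a subtree $T(w)$ and a vertical path $\mathit{path}(u,v)$ ($u$ an ancestor of $v$), the query $Q(T(w),u,v)$ returns an edge $(y,z)$ of $G$ with $y\in\mathit{path}(u,v)$ and $z\in T(w)$ such that $y$ is the highest (closest to the root) vertex of $\mathit{path}(u,v)$ adjacent in $G$ to some vertex of $T(w)$; it returns Null if no edge of $G$ joins $\mathit{path}(u,v)$ and $T(w)$. Algorithm BatchInsert$(T,U)$: (1) add each inserted vertex $v$ to $T$ with $\mathit{par}(v)=r$; (2) set $L(v)=\emptyset$ for each vertex $v$; (3) for each inserted edge $(a,b)$ add $b$ to $L(a)$ and $a$ to $L(b)$; (4) all vertices are initially unvisited; call DFS$(r)$. Procedure DFS$(v)$: let $u=v$; while $\mathit{par}(u)$ exists and is unvisited, set $u=\mathit{par}(u)$. Mark all vertices of $\mathit{path}(u,v)=(w_1=u,w_2,\dots,w_t=v)$ visited. For each $i\in[t]$: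 if $i\neq t$ set $\mathit{par}^*(w_i)=w_{i+1}$; for each child $x$ of $w_i$ in $T$ other than $w_{i+1}$, compute $(y,z)=Q(T(x),u,v)$ with $y\in\mathit{path}(u,v)$ and, if it is not Null, add $z$ to $L(y)$. Then for each $i=1,\dots,t$ in order and each $x\in L(w_i)$: if $x$ is unvisited, set $\mathit{par}^*(x)=w_i$ and call DFS$(x)$. -}

module Defs where

open import Data.Nat using (ℕ; zero; suc)
open import Data.Fin using (Fin; zero; suc; _≟_)
open import Data.Bool using (Bool; true; false; if_then_else_; T)
open import Data.Maybe using (Maybe; just; nothing)
open import Data.List using (List; []; _∷_; _++_; [_]; foldr)
open import Data.List.Membership.Propositional using (_∈_; _∉_)
open import Data.List.Relation.Unary.Unique.Propositional using (Unique)
open import Data.List.Relation.Binary.Permutation.Propositional using (_↭_)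
open import Data.Product using (Σ; _×_; _,_)
open import Data.Sum using (_⊎_)
open import Relation.Nullary using (¬_; does)
open import Relation.Binary.PropositionalEquality using (_≡_; _≢_)

-- Vertices of G+U together with the super root.
-- V n = Fin (suc n); the super root r is `zero`.

V : ℕ → Set
V n = Fin (suc n)

root : ∀ {n} → V n
root = zero

data Anc {n : ℕ} (p : V n → Maybe (V n)) : V n → V n → Set where
  anc-refl : ∀ {x} → Anc p x x
  anc-step : ∀ {x y z} → p y ≡ just z → Anc p x z → Anc p x y

record IsDFSTree {n : ℕ} (Vs : V n → Set) (Adj : V n → V n → Set)
                 (p : V n → Maybe (V n)) : Set where
  field
    root-in    : Vs root
    root-par   : p root ≡ nothing
    tree-edge  : ∀ v → Vs v → v ≢ root →
                 Σ (V n) λ u → p v ≡ just u × Vs u × Adj u v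
    spanning   : ∀ v → Vs v → Anc p root v
    back-edges : ∀ x y → Vs x → Vs y → Adj x y → Anc p x y ⊎ Anc p y x

EdgeIn : ∀ {n} → List (V n × V n) → V n → V n → Set
EdgeIn E x y = (x , y) ∈ E ⊎ (y , x) ∈ E

AdjG : ∀ {n} → List (V n × V n) → V n → V n → Set
AdjG E x y = EdgeIn E x y ⊎ (x ≡ root ⊎ y ≡ root)

AdjGU : ∀ {n} → List (V n × V n) → List (V n × V n) → V n → V n → Set
AdjGU E EU x y = AdjG E x y ⊎ EdgeIn EU x y

upd : ∀ {n} {A : Set} → (V n → A) → V n → A → V n → A
upd f x a y = if does (y ≟ x) then a else f y

record State (n : ℕ) : Set where
  field
    vis : V n → Bool
    L   : V n → List (V n)
    ps  : V n → Maybe (V n)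
open State public

addL : ∀ {n} → V n → V n → (V n → List (V n)) → V n → List (V n)
addL y z L = upd L y (L y ++ [ z ])

addEdges : ∀ {n} → (V n → List (V n)) → List (V n × V n) → V n → List (V n)
addEdges L [] = L
addEdges L ((a , b) ∷ es) = addEdges (addL b a (addL a b L)) es

markAll : ∀ {n} → List (V n) → (V n → Bool) → V n → Bool
markAll ws vis = foldr (λ w f → upd f w true) vis ws

setPath : ∀ {n} → List (V n) → (V n → Maybe (V n)) → V n → Maybe (V n)
setPath (w ∷ x ∷ ws) ps = setPath (x ∷ ws) (upd ps w (just x))
setPath _ ps = ps

data NextOn {n : ℕ} : List (V n) → V n → V n → Set where
  here  : ∀ {w x ws} → NextOn (w ∷ x ∷ ws) w x
  there : ∀ {y w x ws} → NextOn ws w x → NextOn (y ∷ ws) w x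

-- Algorithm BatchInsert, as a (nondeterministic) big-step relation.
-- G: vertex set {v | VG v ≡ true}, edges EG (plus super-root edges);
-- T: parent function par;  U: inserted vertices {v | VG v ≡ false}
-- and inserted edges EU.

module Alg {n : ℕ} (VG : V n → Bool) (EG : List (V n × V n))
           (par : V n → Maybe (V n)) (EU : List (V n × V n)) where

  parT : V n → Maybe (V n)
  parT v = if VG v then par v else just root

  InSub : V n → V n → Set
  InSub x z = Anc parT x z

  σ₀ : State n
  σ₀ = record { vis = λ _ → false ; L = addEdges (λ _ → []) EU ; ps = λ _ → nothing }

  data UpPath (vis : V n → Bool) : V n → List (V n) → Set where
    top  : ∀ {u} → vis u ≡ false →
           (parT u ≡ nothing ⊎ Σ (V n) λ p → parT u ≡ just p × vis p ≡ true) →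
           UpPath vis u [ u ]
    down : ∀ {w v ws} → UpPath vis w ws → parT v ≡ just w → vis v ≡ false →
           UpPath vis v (ws ++ [ v ])

  ChildOff : List (V n) → V n → Set
  ChildOff ws x = Σ (V n) λ w → w ∈ ws × parT x ≡ just w × ¬ NextOn ws w x

  QNull : List (V n) → V n → Set
  QNull ws x = ∀ y z → y ∈ ws → InSub x z → ¬ AdjG EG y z

  QHit : List (V n) → V n → V n → V n → Set
  QHit ws x y z = y ∈ ws × InSub x z × AdjG EG y z ×
                  (∀ y' z' → y' ∈ ws → InSub x z' → AdjG EG y' z' → Anc parT y y')

  data Queries (ws : List (V n)) : List (V n) → (V n → List (V n)) → (V n → List (V n)) → Set where
    q-done : ∀ {L} → Queries ws [] L L
    q-null : ∀ {x xs L L'} → QNull ws x → Queries ws xs L L' → Queries ws (x ∷ xs) L L'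
    q-hit  : ∀ {x xs L L'} y z → QHit ws x y z → Queries ws xs (addL y z L) L' →
             Queries ws (x ∷ xs) L L'

  data Run : V n → State n → State n → Set
  data IterPath : List (V n) → State n → State n → Set
  data IterNbrs : V n → List (V n) → State n → State n → Set

  data Run where
    run : ∀ {v σ σ' L₁} (ws cs : List (V n)) →
          UpPath (vis σ) v ws →
          Unique cs →
          (∀ x → x ∈ cs → ChildOff ws x) →
          (∀ x → ChildOff ws x → x ∈ cs) →
          Queries ws cs (L σ) L₁ →
          IterPath ws (record { vis = markAll ws (vis σ) ; L = L₁ ; ps = setPath ws (ps σ) }) σ' →
          Run v σ σ'

  data IterPath where
    ip-done : ∀ {σ} → IterPath [] σ σ
    ip-next : ∀ {w ws σ σ₁ σ₂} (xs : List (V n)) →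
              xs ↭ L σ w →
              IterNbrs w xs σ σ₁ → IterPath ws σ₁ σ₂ → IterPath (w ∷ ws) σ σ₂

  data IterNbrs where
    in-done  : ∀ {w σ} → IterNbrs w [] σ σ
    in-skip  : ∀ {w x xs σ σ'} → vis σ x ≡ true → IterNbrs w xs σ σ' → IterNbrs w (x ∷ xs) σ σ'
    in-visit : ∀ {w x xs σ σ₁ σ₂} → vis σ x ≡ false →
               Run x (record { vis = vis σ ; L = L σ ; ps = upd (ps σ) x (just w) }) σ₁ →
               IterNbrs w xs σ₁ σ₂ → IterNbrs w (x ∷ xs) σ σ₂

-- BatchInsert maintains an invariant of its state: the visited vertices are closed under
-- parents in T, par* is a tree on them rooted at r whose edges are edges of G+U, and every
-- visited vertex that is not a par*-ancestor of the currently active vertex is finished, i.e.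
-- all its neighbours in G+U are visited and comparable with it. The decisive step is finishing a
-- vertex h = w_i of the path (w_1, ..., w_t): its inserted edges are in L(h); a neighbour above h in T
-- is on the path or was visited earlier; a neighbour b below h in T lies in the subtree T(c) of a
-- child c hanging off the path, and the query Q(T(c), u, v) put some z of T(c) into L(y) for the
-- highest path vertex y adjacent to T(c), which is w_j with j <= i. So z is visited by the time h
-- is finished, and then so is all of T(c), because its visited vertices are already finished.
-- The algorithm terminates since every call of DFS visits a new vertex.

module Submission where

open import Defs
open import Data.Nat using (ℕ; zero; suc; _+_; _≤_; _<_; z≤n; s≤s)
open import Data.Nat.Properties
  using (+-cancelʳ-≡; m+n≡0⇒n≡0; ≤-refl; ≤-trans; ≤-pred; +-mono-≤; +-mono-≤-<; <-≤-trans; n≮0)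
open import Data.Fin using (_≟_)
open import Data.Fin.Properties using (any?)
open import Data.Bool using (Bool; true; false; T; if_then_else_)
open import Data.Bool.Properties using (T-≡)
open import Data.Maybe using (Maybe; just; nothing)
open import Data.Maybe.Properties using (just-injective)
open import Data.List using (List; []; _∷_; _++_; [_]; last; filter; allFin)
open import Data.List.Relation.Unary.Any using (here; there)
import Data.List.Relation.Unary.All as All
open import Data.List.Relation.Unary.All.Properties using (All¬⇒¬Any)
open import Data.List.Relation.Unary.Unique.Propositional using (Unique; []; _∷_)
open import Data.List.Relation.Unary.Unique.Propositional.Properties using (++⁺; filter⁺; allFin⁺)
open import Data.List.Membership.Propositional using (_∈_; _∉_)
open import Data.List.Membership.Propositional.Properties
  using (∈-++⁺ˡ; ∈-++⁺ʳ; ∈-++⁻; ∈-filter⁺; ∈-filter⁻; ∈-allFin)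
open import Data.List.Relation.Binary.Permutation.Propositional using (_↭_; ↭-refl; ↭-sym)
open import Data.List.Relation.Binary.Permutation.Propositional.Properties using (∈-resp-↭)
open import Data.Product using (Σ; ∃₂; _×_; _,_; proj₁; proj₂)
open import Data.Product.Properties using (≡-dec)
open import Data.Sum using (_⊎_; inj₁; inj₂; [_,_]′)
open import Data.Empty using (⊥; ⊥-elim)
open import Data.Unit using (⊤; tt)
open import Function using (_∘_; _∘′_)
open import Function.Bundles using (Equivalence)
open import Relation.Nullary using (¬_; Dec; yes; no)
open import Relation.Nullary.Decidable using (_×-dec_; _⊎-dec_)
open import Relation.Binary.PropositionalEquality using (_≡_; _≢_; refl; sym; trans; cong; subst)

nothing≢just : ∀ {A : Set} {a : A} → nothing ≢ just a
nothing≢just ()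

true≢false : true ≢ false
true≢false ()

T⇒≡true : ∀ {b} → T b → b ≡ true
T⇒≡true = Equivalence.to T-≡

≡true⇒T : ∀ {b} → b ≡ true → T b
≡true⇒T = Equivalence.from T-≡

true⊎false : ∀ b → b ≡ true ⊎ b ≡ false
true⊎false true = inj₁ refl
true⊎false false = inj₂ refl

module Ancestry {n : ℕ} (p : V n → Maybe (V n)) where

  Anc-trans : ∀ {x y z} → Anc p x y → Anc p y z → Anc p x z
  Anc-trans a anc-refl = a
  Anc-trans a (anc-step e b) = anc-step e (Anc-trans a b)

  anc-length : ∀ {x y} → Anc p x y → ℕ
  anc-length anc-refl = 0
  anc-length (anc-step _ a) = suc (anc-length a)

  anc-length-trans : ∀ {x y z} (a : Anc p x y) (b : Anc p y z) →
                     anc-length (Anc-trans a b) ≡ anc-length b + anc-length a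
  anc-length-trans a anc-refl = refl
  anc-length-trans a (anc-step e b) = cong suc (anc-length-trans a b)

  anc-length-unique : ∀ {r y} → p r ≡ nothing → (a b : Anc p r y) → anc-length a ≡ anc-length b
  anc-length-unique h anc-refl anc-refl = refl
  anc-length-unique h anc-refl (anc-step e b) = ⊥-elim (nothing≢just (trans (sym h) e))
  anc-length-unique h (anc-step e a) anc-refl = ⊥-elim (nothing≢just (trans (sym h) e))
  anc-length-unique h (anc-step e a) (anc-step e' b) with just-injective (trans (sym e) e')
  ... | refl = cong suc (anc-length-unique h a b)

  -- Below a parentless vertex r every vertex has a unique depth, so a cycle has length zero.
  cycle-length-zero : ∀ {r a} → p r ≡ nothing → Anc p r a → (c : Anc p a a) → anc-length c ≡ 0
  cycle-length-zero h ra c =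
    +-cancelʳ-≡ (anc-length ra) (anc-length c) 0
      (sym (trans (anc-length-unique h ra (Anc-trans ra c)) (anc-length-trans ra c)))

  Anc-antisym : ∀ {r a b} → p r ≡ nothing → Anc p r a → Anc p a b → Anc p b a → a ≡ b
  Anc-antisym h ra anc-refl ba = refl
  Anc-antisym h ra ab@(anc-step _ _) ba
    with m+n≡0⇒n≡0 (anc-length ba) (trans (sym (anc-length-trans ab ba)) (cycle-length-zero h ra (Anc-trans ab ba)))
  ... | ()

  ¬Anc-parent : ∀ {r v w} → p r ≡ nothing → Anc p r w → p v ≡ just w → ¬ Anc p v w
  ¬Anc-parent h rw e vw with Anc-antisym h rw (anc-step e anc-refl) vw
  ... | refl with cycle-length-zero h rw (anc-step e anc-refl)
  ... | ()

  AncM : Maybe (V n) → V n → Set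
  AncM nothing v = ⊥
  AncM (just w) v = Anc p v w

  Anc-split : ∀ {v y} → Anc p v y → v ≡ y ⊎ AncM (p y) v
  Anc-split anc-refl = inj₁ refl
  Anc-split (anc-step e a) rewrite e = inj₂ a

  Anc-closed : (S : V n → Set) → (∀ y z → S y → p y ≡ just z → S z) →
               ∀ {a b} → Anc p a b → S b → S a
  Anc-closed S closed anc-refl sb = sb
  Anc-closed S closed (anc-step e a) sb = Anc-closed S closed a (closed _ _ sb e)

  Anc-dec : ∀ {r y} → p r ≡ nothing → Anc p r y → ∀ a → Dec (Anc p a y)
  Anc-dec {r} h anc-refl a with a ≟ r
  ... | yes refl = yes anc-refl
  ... | no a≢r = no λ { anc-refl → a≢r refl ; (anc-step e _) → nothing≢just (trans (sym h) e) }
  Anc-dec h (anc-step {y = y} e ra) a with a ≟ y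
  ... | yes refl = yes anc-refl
  ... | no a≢y with Anc-dec h ra a
  ...   | yes az = yes (anc-step e az)
  ...   | no ¬az = no λ { anc-refl → a≢y refl
                        ; (anc-step e' az) → ¬az (subst (Anc p a) (just-injective (trans (sym e') e)) az) }

Anc-transport : ∀ {n} (p p' : V n → Maybe (V n)) (S : V n → Set) →
                (∀ y z → S y → p y ≡ just z → S z) → (∀ y → S y → p' y ≡ p y) →
                ∀ {a b} → Anc p a b → S b → Anc p' a b
Anc-transport p p' S closed agree anc-refl sb = anc-refl
Anc-transport p p' S closed agree (anc-step {y = y} e a) sb =
  anc-step (trans (agree y sb) e) (Anc-transport p p' S closed agree a (closed _ _ sb e))

module _ {n : ℕ} where

  upd-same : ∀ {A : Set} (f : V n → A) x a → upd f x a x ≡ a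
  upd-same f x a with x ≟ x
  ... | yes _ = refl
  ... | no x≢x = ⊥-elim (x≢x refl)

  upd-other : ∀ {A : Set} (f : V n → A) x a y → y ≢ x → upd f x a y ≡ f y
  upd-other f x a y y≢x with y ≟ x
  ... | yes y≡x = ⊥-elim (y≢x y≡x)
  ... | no _ = refl

  markAll-∈ : ∀ ws (f : V n → Bool) y → y ∈ ws → markAll ws f y ≡ true
  markAll-∈ (w ∷ ws) f y (here refl) = upd-same (markAll ws f) y true
  markAll-∈ (w ∷ ws) f y (there m) with y ≟ w
  ... | yes _ = refl
  ... | no _ = markAll-∈ ws f y m

  markAll-old : ∀ ws (f : V n → Bool) y → f y ≡ true → markAll ws f y ≡ true
  markAll-old [] f y e = e
  markAll-old (w ∷ ws) f y e with y ≟ w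
  ... | yes _ = refl
  ... | no _ = markAll-old ws f y e

  markAll⁻ : ∀ ws (f : V n → Bool) y → markAll ws f y ≡ true → y ∈ ws ⊎ f y ≡ true
  markAll⁻ [] f y e = inj₂ e
  markAll⁻ (w ∷ ws) f y e with y ≟ w
  ... | yes refl = inj₁ (here refl)
  ... | no _ = [ inj₁ ∘′ there , inj₂ ]′ (markAll⁻ ws f y e)

  last-∈ : ∀ ws {x : V n} → last ws ≡ just x → x ∈ ws
  last-∈ (a ∷ []) refl = here refl
  last-∈ (a ∷ b ∷ ws) l = there (last-∈ (b ∷ ws) l)

  last-snoc : ∀ ws (v : V n) → last (ws ++ [ v ]) ≡ just v
  last-snoc [] v = refl
  last-snoc (a ∷ []) v = refl
  last-snoc (a ∷ b ∷ ws) v = last-snoc (b ∷ ws) v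

  Unique-snoc : ∀ {ws} {v : V n} → Unique ws → v ∉ ws → Unique (ws ++ [ v ])
  Unique-snoc u v∉ = ++⁺ u (All.[] ∷ []) λ { (m , here refl) → v∉ m }

module _ {A : Set} where

  unmarkedCount : (A → Bool) → List A → ℕ
  unmarkedCount f [] = 0
  unmarkedCount f (v ∷ vs) = (if f v then 0 else 1) + unmarkedCount f vs

  private
    weight-mono : ∀ b b' → (b ≡ true → b' ≡ true) → (if b' then 0 else 1) ≤ (if b then 0 else 1)
    weight-mono true true _ = z≤n
    weight-mono true false imp = ⊥-elim (true≢false (sym (imp refl)))
    weight-mono false true _ = z≤n
    weight-mono false false _ = s≤s z≤n

  unmarkedCount-mono : ∀ (f f' : A → Bool) → (∀ v → f v ≡ true → f' v ≡ true) →
                       ∀ vs → unmarkedCount f' vs ≤ unmarkedCount f vs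
  unmarkedCount-mono f f' imp [] = z≤n
  unmarkedCount-mono f f' imp (v ∷ vs) = +-mono-≤ (weight-mono (f v) (f' v) (imp v)) (unmarkedCount-mono f f' imp vs)

  unmarkedCount-strict : ∀ (f f' : A → Bool) → (∀ v → f v ≡ true → f' v ≡ true) → ∀ {vs v} → v ∈ vs →
                         f v ≡ false → f' v ≡ true → unmarkedCount f' vs < unmarkedCount f vs
  unmarkedCount-strict f f' imp {v ∷ vs} (here refl) fv f'v rewrite fv | f'v = s≤s (unmarkedCount-mono f f' imp vs)
  unmarkedCount-strict f f' imp {a ∷ vs} (there m) fv f'v =
    +-mono-≤-< (weight-mono (f a) (f' a) (imp a)) (unmarkedCount-strict f f' imp m fv f'v)

module _ {n : ℕ} where

  NextOn-∈ˡ : ∀ {ws : List (V n)} {w x} → NextOn ws w x → w ∈ ws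
  NextOn-∈ˡ here = here refl
  NextOn-∈ˡ (there nx) = there (NextOn-∈ˡ nx)

  NextOn-∈ʳ : ∀ {ws : List (V n)} {w x} → NextOn ws w x → x ∈ ws
  NextOn-∈ʳ here = there (here refl)
  NextOn-∈ʳ (there nx) = there (NextOn-∈ʳ nx)

  headOr : List (V n) → V n → V n
  headOr [] x = x
  headOr (h ∷ _) x = h

  headOrM : List (V n) → Maybe (V n) → Maybe (V n)
  headOrM [] g = g
  headOrM (h ∷ _) g = just h

module Paths {n : ℕ} (p : V n → Maybe (V n)) where
  open Ancestry p

  Descends : List (V n) → Set
  Descends [] = ⊤
  Descends (a ∷ []) = ⊤
  Descends (a ∷ b ∷ ws) = p b ≡ just a × Descends (b ∷ ws)

  Ascends : List (V n) → V n → Set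
  Ascends [] x = ⊤
  Ascends (h ∷ []) x = h ≡ x
  Ascends (h ∷ h' ∷ ws) x = p h ≡ just h' × Ascends (h' ∷ ws) x

  Stops : (V n → Bool) → List (V n) → Set
  Stops f [] = ⊥
  Stops f (u ∷ _) = p u ≡ nothing ⊎ Σ (V n) λ z → p u ≡ just z × f z ≡ true

  Descends-tail : ∀ h ws → Descends (h ∷ ws) → Descends ws
  Descends-tail h [] d = tt
  Descends-tail h (h' ∷ ws) (e , d) = d

  Descends-snoc : ∀ ws {w} v → Descends ws → last ws ≡ just w → p v ≡ just w → Descends (ws ++ [ v ])
  Descends-snoc (a ∷ []) v d refl e = e , tt
  Descends-snoc (a ∷ b ∷ ws) v (e' , d) l e = e' , Descends-snoc (b ∷ ws) v d l e

  Descends-Anc : ∀ h ws → Descends (h ∷ ws) → ∀ {y} → y ∈ ws → Anc p h y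
  Descends-Anc h (h' ∷ ws) (e , d) (here refl) = anc-step e anc-refl
  Descends-Anc h (h' ∷ ws) (e , d) (there m) = Anc-trans (anc-step e anc-refl) (Descends-Anc h' ws d m)

  Descends-parent : ∀ u ws → Descends (u ∷ ws) → ∀ {y} → y ∈ u ∷ ws →
                    y ≡ u ⊎ Σ (V n) λ z → p y ≡ just z × NextOn (u ∷ ws) z y
  Descends-parent u ws d (here e) = inj₁ e
  Descends-parent u (b ∷ ws) (e , d) (there m) with Descends-parent b ws d m
  ... | inj₁ refl = inj₂ (u , e , here)
  ... | inj₂ (z , e' , nx) = inj₂ (z , e' , there nx)

  Descends-parent-closed : ∀ f ws → Stops f ws → Descends ws → ∀ {y z} → y ∈ ws → p y ≡ just z →
                           z ∈ ws ⊎ f z ≡ true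
  Descends-parent-closed f (u ∷ ws) s d m e with Descends-parent u ws d m | s
  ... | inj₁ refl | inj₁ noParent = ⊥-elim (nothing≢just (trans (sym noParent) e))
  ... | inj₁ refl | inj₂ (z , e' , fz) rewrite just-injective (trans (sym e) e') = inj₂ fz
  ... | inj₂ (z , e' , nx) | _ rewrite just-injective (trans (sym e) e') = inj₁ (NextOn-∈ˡ nx)

  Descends-Anc-closed : ∀ f → (∀ y z → f y ≡ true → p y ≡ just z → f z ≡ true) →
                        ∀ ws → Stops f ws → Descends ws →
                        ∀ {c y} → y ∈ ws → Anc p c y → c ∈ ws ⊎ f c ≡ true
  Descends-Anc-closed f closed ws s d m anc-refl = inj₁ m
  Descends-Anc-closed f closed ws s d m (anc-step e a) with Descends-parent-closed f ws s d m e
  ... | inj₁ m' = Descends-Anc-closed f closed ws s d m' a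
  ... | inj₂ fz = inj₂ (Anc-closed (λ v → f v ≡ true) closed a fz)

  Ascends-tail : ∀ {x} h ws → Ascends (h ∷ ws) x → Ascends ws x
  Ascends-tail h [] a = tt
  Ascends-tail h (h' ∷ ws) (e , a) = a

  Ascends-Anc-head : ∀ {x} h ws → Ascends (h ∷ ws) x → ∀ {y} → y ∈ ws → Anc p y h
  Ascends-Anc-head h (h' ∷ ws) (e , a) (here refl) = anc-step e anc-refl
  Ascends-Anc-head h (h' ∷ ws) (e , a) (there m) = Anc-trans (Ascends-Anc-head h' ws a m) (anc-step e anc-refl)

  Ascends-Anc-end : ∀ {x} ws → Ascends ws x → ∀ {h} → h ∈ ws → Anc p x h
  Ascends-Anc-end (a ∷ []) refl (here refl) = anc-refl
  Ascends-Anc-end (a ∷ a' ∷ ws) (e , as) (here refl) =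
    Anc-trans (Ascends-Anc-end (a' ∷ ws) as (here refl)) (anc-step e anc-refl)
  Ascends-Anc-end (a ∷ a' ∷ ws) (e , as) (there m) = Ascends-Anc-end (a' ∷ ws) as m

  Ascends-next : ∀ {x g} h ws → Ascends (h ∷ ws) x → p x ≡ g → p h ≡ headOrM ws g
  Ascends-next h [] refl e = e
  Ascends-next h (h' ∷ ws) (e , a) _ = e

  Ascends-Anc-next : ∀ {x} h ws → Ascends (h ∷ ws) x → Anc p (headOr ws x) h
  Ascends-Anc-next h [] refl = anc-refl
  Ascends-Anc-next h (h' ∷ ws) (e , a) = anc-step e anc-refl

Ascends-agree : ∀ {n} (p p' : V n → Maybe (V n)) {x} ws → (∀ y → y ∈ ws → p' y ≡ p y) →
                Paths.Ascends p ws x → Paths.Ascends p' ws x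
Ascends-agree p p' [] agree a = tt
Ascends-agree p p' (h ∷ []) agree a = a
Ascends-agree p p' (h ∷ h' ∷ ws) agree (e , a) =
  trans (agree h (here refl)) e , Ascends-agree p p' (h' ∷ ws) (λ y m → agree y (there m)) a

module _ {n : ℕ} where
  open Paths

  setPath-∉ : ∀ ws (q : V n → Maybe (V n)) y → y ∉ ws → setPath ws q y ≡ q y
  setPath-∉ [] q y y∉ = refl
  setPath-∉ (w ∷ []) q y y∉ = refl
  setPath-∉ (w ∷ w' ∷ ws) q y y∉ =
    trans (setPath-∉ (w' ∷ ws) _ y (λ m → y∉ (there m))) (upd-other q w _ y (λ e → y∉ (here e)))

  setPath-ascends : ∀ ws (q : V n → Maybe (V n)) {x} → Unique ws → last ws ≡ just x →
                    Ascends (setPath ws q) ws x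
  setPath-ascends (w ∷ []) q u refl = refl
  setPath-ascends (w ∷ w' ∷ ws) q (w∉ ∷ u) l =
    trans (setPath-∉ (w' ∷ ws) _ w (All¬⇒¬Any w∉)) (upd-same q w _) , setPath-ascends (w' ∷ ws) _ u l

  setPath-last : ∀ ws (q : V n → Maybe (V n)) {x} → Unique ws → last ws ≡ just x → setPath ws q x ≡ q x
  setPath-last (w ∷ []) q u refl = refl
  setPath-last (w ∷ w' ∷ ws) q {x} (w∉ ∷ u) l =
    trans (setPath-last (w' ∷ ws) _ u l)
          (upd-other q w _ x (λ { refl → All¬⇒¬Any w∉ (last-∈ (w' ∷ ws) l) }))

  addL-mono : ∀ y z (L : V n → List (V n)) a b → b ∈ L a → b ∈ addL y z L a
  addL-mono y z L a b m with a ≟ y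
  ... | yes refl = ∈-++⁺ˡ m
  ... | no _ = m

  addL-new : ∀ y z (L : V n → List (V n)) → z ∈ addL y z L y
  addL-new y z L with y ≟ y
  ... | yes _ = ∈-++⁺ʳ (L y) (here refl)
  ... | no y≢y = ⊥-elim (y≢y refl)

  addL⁻ : ∀ y z (L : V n → List (V n)) a b → b ∈ addL y z L a → b ∈ L a ⊎ (a ≡ y × b ≡ z)
  addL⁻ y z L a b m with a ≟ y
  ... | no _ = inj₁ m
  ... | yes refl with ∈-++⁻ (L a) m
  ...   | inj₁ m' = inj₁ m'
  ...   | inj₂ (here e) = inj₂ (refl , e)

  addEdges-mono : ∀ (L : V n → List (V n)) es a b → b ∈ L a → b ∈ addEdges L es a
  addEdges-mono L [] a b m = m
  addEdges-mono L ((x , y) ∷ es) a b m = addEdges-mono _ es a b (addL-mono y x _ a b (addL-mono x y L a b m))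

  addEdges-edge : ∀ (L : V n → List (V n)) es a b → EdgeIn es a b → b ∈ addEdges L es a
  addEdges-edge L (_ ∷ es) a b (inj₁ (here refl)) =
    addEdges-mono _ es a b (addL-mono b a (addL a b L) a b (addL-new a b L))
  addEdges-edge L (_ ∷ es) a b (inj₂ (here refl)) = addEdges-mono _ es a b (addL-new a b (addL b a L))
  addEdges-edge L (_ ∷ es) a b (inj₁ (there m)) = addEdges-edge _ es a b (inj₁ m)
  addEdges-edge L (_ ∷ es) a b (inj₂ (there m)) = addEdges-edge _ es a b (inj₂ m)

  addEdges⁻ : ∀ (P : V n → V n → Set) (L : V n → List (V n)) es → (∀ a b → b ∈ L a → P a b) →
              (∀ a b → EdgeIn es a b → P a b) → ∀ a b → b ∈ addEdges L es a → P a b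
  addEdges⁻ P L [] inL inE a b m = inL a b m
  addEdges⁻ P L ((x , y) ∷ es) inL inE =
    addEdges⁻ P _ es inL' (λ a b → inE a b ∘ [ inj₁ ∘ there , inj₂ ∘ there ]′)
    where
    inL' : ∀ a b → b ∈ addL y x (addL x y L) a → P a b
    inL' a b m with addL⁻ y x _ a b m
    ... | inj₂ (refl , refl) = inE _ _ (inj₂ (here refl))
    ... | inj₁ m' with addL⁻ x y L a b m'
    ...   | inj₁ m'' = inL a b m''
    ...   | inj₂ (refl , refl) = inE _ _ (inj₁ (here refl))

AdjG-sym : ∀ {n} (E : List (V n × V n)) a b → AdjG E a b → AdjG E b a
AdjG-sym E a b (inj₁ e) = inj₁ ([ inj₂ , inj₁ ]′ e)
AdjG-sym E a b (inj₂ r) = inj₂ ([ inj₂ , inj₁ ]′ r)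

AdjGU-sym : ∀ {n} (E EU : List (V n × V n)) a b → AdjGU E EU a b → AdjGU E EU b a
AdjGU-sym E EU a b (inj₁ g) = inj₁ (AdjG-sym E a b g)
AdjGU-sym E EU a b (inj₂ u) = inj₂ ([ inj₂ , inj₁ ]′ u)

module BatchInsertProof {n : ℕ} (VG : V n → Bool) (EG : List (V n × V n))
  (par : V n → Maybe (V n)) (EU : List (V n × V n))
  (G-edges : ∀ x y → (x , y) ∈ EG → T (VG x) × T (VG y))
  (dfsT : IsDFSTree (λ v → T (VG v)) (AdjG EG) par) where
  open Alg VG EG par EU
  open IsDFSTree dfsT
  open Ancestry
  open Paths
  open import Data.List.Membership.DecPropositional (_≟_ {suc n}) using (_∈?_)

  Vtx : Set
  Vtx = V n

  Adj : Vtx → Vtx → Set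
  Adj = AdjGU EG EU

  InG : Vtx → Set
  InG v = T (VG v)

  parT-old : ∀ v → InG v → parT v ≡ par v
  parT-old v Gv = cong (λ b → if b then par v else just root) (T⇒≡true Gv)

  parT-new : ∀ v → VG v ≡ false → parT v ≡ just root
  parT-new v e = cong (λ b → if b then par v else just root) e

  parT-root : parT root ≡ nothing
  parT-root = trans (parT-old root root-in) root-par

  par-closed : ∀ y z → InG y → par y ≡ just z → InG z
  par-closed y z Gy e with y ≟ root
  ... | yes refl = ⊥-elim (nothing≢just (trans (sym root-par) e))
  ... | no y≢r with tree-edge y Gy y≢r
  ...   | u , e' , Gu , _ = subst InG (just-injective (trans (sym e') e)) Gu

  Anc-par⇒parT : ∀ {a b} → Anc par a b → InG b → Anc parT a b
  Anc-par⇒parT = Anc-transport par parT InG par-closed parT-old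

  parT-spanning : ∀ v → Anc parT root v
  parT-spanning v with VG v in eq
  ... | true = Anc-par⇒parT (spanning v (≡true⇒T eq)) (≡true⇒T eq)
  ... | false = anc-step (parT-new v eq) anc-refl

  parT-edge : ∀ v u → parT v ≡ just u → AdjG EG u v
  parT-edge v u e with VG v in eq
  ... | false = subst (λ w → AdjG EG w v) (just-injective e) (inj₂ (inj₁ refl))
  ... | true with v ≟ root
  ...   | yes refl = ⊥-elim (nothing≢just (trans (sym root-par) e))
  ...   | no v≢r with tree-edge v (≡true⇒T eq) v≢r
  ...     | u' , e' , _ , adj = subst (λ w → AdjG EG w v) (just-injective (trans (sym e') e)) adj

  parT-back-edges : ∀ a b → AdjG EG a b → Anc parT a b ⊎ Anc parT b a
  parT-back-edges a b (inj₂ (inj₁ refl)) = inj₁ (parT-spanning b)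
  parT-back-edges a b (inj₂ (inj₂ refl)) = inj₂ (parT-spanning a)
  parT-back-edges a b (inj₁ ab) with ends ab
    where
    ends : EdgeIn EG a b → InG a × InG b
    ends (inj₁ m) = G-edges a b m
    ends (inj₂ m) = let (Gb , Ga) = G-edges b a m in Ga , Gb
  ... | Ga , Gb with back-edges a b Ga Gb (inj₁ ab)
  ...   | inj₁ a≤b = inj₁ (Anc-par⇒parT a≤b Gb)
  ...   | inj₂ b≤a = inj₂ (Anc-par⇒parT b≤a Ga)

  parT-antisym : ∀ {a b} → Anc parT a b → Anc parT b a → a ≡ b
  parT-antisym {a} = Anc-antisym parT parT-root (parT-spanning a)

  ¬Anc-parT-parent : ∀ {v w} → parT v ≡ just w → ¬ Anc parT v w
  ¬Anc-parT-parent {w = w} = ¬Anc-parent parT parT-root (parT-spanning w)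

  record ClimbFacts (f : Vtx → Bool) (x : Vtx) (ws : List Vtx) : Set where
    field
      unmarked : ∀ y → y ∈ ws → f y ≡ false
      descends : Descends parT ws
      ends-at  : last ws ≡ just x
      unique   : Unique ws
      stops    : Stops parT f ws
      below    : ∀ y → y ∈ ws → Anc parT y x

  upPath-facts : ∀ {f x ws} → UpPath f x ws → ClimbFacts f x ws
  upPath-facts (top e s) = record
    { unmarked = λ { y (here refl) → e }
    ; descends = tt ; ends-at = refl ; unique = All.[] ∷ [] ; stops = s
    ; below = λ { y (here refl) → anc-refl } }
  upPath-facts {f} (down {w} {v} {ws} up e v-unmarked) = record
    { unmarked = λ y m → [ unmarked y , (λ { refl → v-unmarked }) ]′ (∈-snoc m)
    ; descends = Descends-snoc parT ws v descends ends-at e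
    ; ends-at = last-snoc ws v
    ; unique = Unique-snoc unique (λ m → ¬Anc-parT-parent e (below v m))
    ; stops = stops-snoc ws stops
    ; below = λ y m → [ (λ m' → anc-step e (below y m')) , (λ { refl → anc-refl }) ]′ (∈-snoc m) }
    where
    open ClimbFacts (upPath-facts up)
    ∈-snoc : ∀ {y} → y ∈ ws ++ [ v ] → y ∈ ws ⊎ y ≡ v
    ∈-snoc m with ∈-++⁻ ws m
    ... | inj₁ m' = inj₁ m'
    ... | inj₂ (here e) = inj₂ e
    stops-snoc : ∀ us → Stops parT f us → Stops parT f (us ++ [ v ])
    stops-snoc (u ∷ _) s = s

  queries-L-mono : ∀ {ws cs L L'} → Queries ws cs L L' → ∀ a b → b ∈ L a → b ∈ L' a
  queries-L-mono q-done a b m = m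
  queries-L-mono (q-null _ q) a b m = queries-L-mono q a b m
  queries-L-mono (q-hit y z _ q) a b m = queries-L-mono q a b (addL-mono y z _ a b m)

  queries-edges : ∀ {ws cs L L'} → Queries ws cs L L' → (∀ a b → b ∈ L a → Adj a b) →
                  ∀ a b → b ∈ L' a → Adj a b
  queries-edges q-done ok = ok
  queries-edges (q-null _ q) ok = queries-edges q ok
  queries-edges {L = L} (q-hit y z (_ , _ , yz , _) q) ok = queries-edges q ok'
    where
    ok' : ∀ a b → b ∈ addL y z L a → Adj a b
    ok' a b m with addL⁻ y z L a b m
    ... | inj₁ m' = ok a b m'
    ... | inj₂ (refl , refl) = inj₁ yz

  QueryResult : List Vtx → (Vtx → List Vtx) → Vtx → Set
  QueryResult ws L c = QNull ws c ⊎ Σ Vtx λ y → Σ Vtx λ z → QHit ws c y z × z ∈ L y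

  queries-result : ∀ {ws cs L L'} → Queries ws cs L L' → ∀ c → c ∈ cs → QueryResult ws L' c
  queries-result (q-null qn q) c (here refl) = inj₁ qn
  queries-result (q-null qn q) c (there m) = queries-result q c m
  queries-result {L = L} (q-hit y z qh q) c (here refl) = inj₂ (y , z , qh , queries-L-mono q y z (addL-new y z L))
  queries-result (q-hit y z qh q) c (there m) = queries-result q c m

  Visited : State n → Vtx → Set
  Visited σ v = vis σ v ≡ true

  -- g is the vertex whose DFS call is active; the vertices above it are exactly the unfinished ones.
  record Invariant (σ : State n) (g : Maybe Vtx) : Set where
    field
      parT-closed : ∀ y z → Visited σ y → parT y ≡ just z → Visited σ z
      ps-root     : ps σ root ≡ nothing
      ps-edge     : ∀ v → Visited σ v → v ≢ root → Σ Vtx λ u → ps σ v ≡ just u × Visited σ u × Adj u v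
      ps-spanning : ∀ v → Visited σ v → Anc (ps σ) root v
      finished    : ∀ a b → Visited σ a → ¬ AncM (ps σ) g a → Adj a b →
                    Visited σ b × (Anc (ps σ) a b ⊎ Anc (ps σ) b a)
      L-initial   : ∀ a b → b ∈ L σ₀ a → b ∈ L σ a
      L-edges     : ∀ a b → b ∈ L σ a → Adj a b

  Attached : Maybe Vtx → Vtx → State n → Set
  Attached nothing x σ = x ≡ root
  Attached (just w) x σ = Visited σ w × Adj w x

  record RunSpec (x : Vtx) (g : Maybe Vtx) (σ σ' : State n) : Set where
    field
      invariant : Invariant σ' g
      vis-mono  : ∀ v → Visited σ v → Visited σ' v
      ps-stable : ∀ v → Visited σ v → ps σ' v ≡ ps σ v
      ps-x      : ps σ' x ≡ ps σ x
      new-below : ∀ v → Visited σ' v → vis σ v ≡ false → Anc (ps σ') x v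
      L-mono    : ∀ a b → b ∈ L σ a → b ∈ L σ' a
      x-visited : Visited σ' x

  record NbrsSpec (h : Vtx) (xs : List Vtx) (σ σ' : State n) : Set where
    field
      invariant   : Invariant σ' (just h)
      vis-mono    : ∀ v → Visited σ v → Visited σ' v
      ps-stable   : ∀ v → Visited σ v → ps σ' v ≡ ps σ v
      new-below   : ∀ v → Visited σ' v → vis σ v ≡ false → Anc (ps σ') h v
      L-mono      : ∀ a b → b ∈ L σ a → b ∈ L σ' a
      all-visited : ∀ y → y ∈ xs → Visited σ' y

  module _ {σ : State n} {g : Maybe Vtx} (I : Invariant σ g) where
    open Invariant I

    ps-closed : ∀ y z → Visited σ y → ps σ y ≡ just z → Visited σ z
    ps-closed y z vy e with y ≟ root
    ... | yes refl = ⊥-elim (nothing≢just (trans (sym ps-root) e))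
    ... | no y≢r with ps-edge y vy y≢r
    ...   | u , e' , vu , _ = subst (Visited σ) (just-injective (trans (sym e') e)) vu

    Anc-keep : ∀ (σ' : State n) → (∀ v → Visited σ v → ps σ' v ≡ ps σ v) →
               ∀ {a b} → Anc (ps σ) a b → Visited σ b → Anc (ps σ') a b
    Anc-keep σ' agree = Anc-transport (ps σ) (ps σ') (Visited σ) ps-closed agree

    ps-antisym : ∀ {a b} → Visited σ a → Anc (ps σ) a b → Anc (ps σ) b a → a ≡ b
    ps-antisym {a} va = Anc-antisym (ps σ) ps-root (ps-spanning a va)

    root-visited : ∀ v → Visited σ v → Visited σ root
    root-visited v vv = Anc-closed (ps σ) (Visited σ) ps-closed (ps-spanning v vv) vv

    Anc-ps-dec : ∀ {w} → Visited σ w → ∀ a → Dec (Anc (ps σ) a w)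
    Anc-ps-dec {w} vw = Anc-dec (ps σ) ps-root (ps-spanning w vw)

  attach : State n → Vtx → Vtx → State n
  attach σ x h = record { vis = vis σ ; L = L σ ; ps = upd (ps σ) x (just h) }

  attach-old : ∀ {σ x} h → vis σ x ≡ false → ∀ v → Visited σ v → ps (attach σ x h) v ≡ ps σ v
  attach-old {σ} {x} h vx v vv = upd-other (ps σ) x (just h) v (λ { refl → true≢false (trans (sym vv) vx) })

  invariant-attach : ∀ {σ h x} → Invariant σ (just h) → Visited σ h → vis σ x ≡ false →
                     Invariant (attach σ x h) (just h)
  invariant-attach {σ} {h} {x} I vh vx = record
    { parT-closed = parT-closed
    ; ps-root = trans (agree root (root-visited I h vh)) ps-root
    ; ps-edge = λ v vv v≢r → let (u , e , vu , ad) = ps-edge v vv v≢r in u , trans (agree v vv) e , vu , ad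
    ; ps-spanning = λ v vv → Anc-keep I σx agree (ps-spanning v vv) vv
    ; finished = finished'
    ; L-initial = L-initial
    ; L-edges = L-edges }
    where
    open Invariant I
    σx : State n
    σx = attach σ x h
    agree : ∀ v → Visited σ v → ps σx v ≡ ps σ v
    agree = attach-old {σ} h vx
    finished' : ∀ a b → Visited σ a → ¬ Anc (ps σx) a h → Adj a b →
                Visited σ b × (Anc (ps σx) a b ⊎ Anc (ps σx) b a)
    finished' a b va ¬ah ad with finished a b va (λ ah → ¬ah (Anc-keep I σx agree ah vh)) ad
    ... | vb , inj₁ ab = vb , inj₁ (Anc-keep I σx agree ab vb)
    ... | vb , inj₂ ba = vb , inj₂ (Anc-keep I σx agree ba va)

  child∉path : ∀ (f : Vtx → Bool) ws → Stops parT f ws → Descends parT ws →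
               (∀ y → y ∈ ws → f y ≡ false) →
               ∀ c → ChildOff ws c → c ∉ ws
  child∉path f (u ∷ ws) s d unmarked c (y , y∈ , ec , ¬next) m with Descends-parent parT u ws d m | s
  ... | inj₁ refl | inj₁ noParent = nothing≢just (trans (sym noParent) ec)
  ... | inj₁ refl | inj₂ (z , ez , fz) rewrite just-injective (trans (sym ez) ec) =
        true≢false (trans (sym fz) (unmarked y y∈))
  ... | inj₂ (z , ez , nx) | _ rewrite just-injective (trans (sym ez) ec) = ¬next nx

  path-successor : ∀ {q : Vtx → Maybe Vtx} {x} ws → Ascends q ws x → Descends parT ws →
                   ∀ {v} → v ∈ ws → v ≢ x →
                   Σ Vtx λ v' → q v ≡ just v' × v' ∈ ws × parT v' ≡ just v
  path-successor (a ∷ []) refl d (here refl) v≢x = ⊥-elim (v≢x refl)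
  path-successor (a ∷ a' ∷ ws) (e , as) (et , d) (here refl) v≢x = a' , e , there (here refl) , et
  path-successor (a ∷ a' ∷ ws) (e , as) (et , d) (there m) v≢x with path-successor (a' ∷ ws) as d m v≢x
  ... | v' , e1 , m1 , e2 = v' , e1 , there m1 , e2

  path-active : ∀ {q : Vtx → Maybe Vtx} {x} {g : Maybe Vtx} ws → Ascends q ws x → q x ≡ g →
                (∀ a → a ∈ ws → AncM q (headOrM ws g) a) × (∀ a → AncM q g a → AncM q (headOrM ws g) a)
  path-active [] as e = (λ a ()) , (λ a act → act)
  path-active {q} {x} {g} (u ∷ ws) as e = on-path , above-g g e
    where
    on-path : ∀ a → a ∈ u ∷ ws → Anc q a u
    on-path a (here refl) = anc-refl
    on-path a (there m) = Ascends-Anc-head q u ws as m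
    above-g : ∀ g' → q x ≡ g' → ∀ a → AncM q g' a → Anc q a u
    above-g (just w) e a aw = Anc-trans q (anc-step e aw) (Ascends-Anc-end q (u ∷ ws) as (here refl))

  record RunContext : Set where
    field
      x : Vtx
      g : Maybe Vtx
      σ : State n
      ws : List Vtx
      cs : List Vtx
      L₁ : Vtx → List Vtx
      I : Invariant σ g
      attached : Attached g x σ
      ps-x : ps σ x ≡ g
      climb : ClimbFacts (vis σ) x ws
      cs-complete : ∀ c → ChildOff ws c → c ∈ cs
      results : ∀ c → c ∈ cs → QueryResult ws L₁ c
      L-sub : ∀ a b → b ∈ L σ a → b ∈ L₁ a
      L₁-edges : ∀ a b → b ∈ L₁ a → Adj a b

  module PathLoop (C : RunContext) where
    open RunContext C
    open ClimbFacts climb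

    σm : State n
    σm = record { vis = markAll ws (vis σ) ; L = L₁ ; ps = setPath ws (ps σ) }

    -- ws' is the part of the path still to be processed.
    record PathInvariant (ws' : List Vtx) (σa : State n) : Set where
      field
        invariant    : Invariant σa (headOrM ws' g)
        vis-mono     : ∀ v → Visited σ v → Visited σa v
        path-visited : ∀ v → v ∈ ws → Visited σa v
        ps-stable    : ∀ v → Visited σ v → ps σa v ≡ ps σ v
        ascends      : Ascends (ps σa) ws' x
        ps-x-kept        : ps σa x ≡ g
        rest-descends    : Descends parT ws'
        suffix       : ∀ y → y ∈ ws' → y ∈ ws
        new-vertices : ∀ v → Visited σa v → vis σ v ≡ false → v ∈ ws' ⊎ Anc (ps σa) (headOr ws' x) v
        L-mono       : ∀ a b → b ∈ L₁ a → b ∈ L σa a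

    old∉path : ∀ v → Visited σ v → v ∉ ws
    old∉path v vv m = true≢false (trans (sym vv) (unmarked v m))

    child-unvisited : ∀ c → ChildOff ws c → vis σ c ≡ false
    child-unvisited c (y , y∈ , ec , _) with true⊎false (vis σ c)
    ... | inj₂ f = f
    ... | inj₁ t = ⊥-elim (old∉path y (Invariant.parT-closed I c y t ec) y∈)

    subtree∉path : ∀ {c v} → ChildOff ws c → Anc parT c v → v ∉ ws
    subtree∉path {c} co cv m with Descends-Anc-closed parT (vis σ) (Invariant.parT-closed I) ws stops descends m cv
    ... | inj₁ c∈ = child∉path (vis σ) ws stops descends unmarked c co c∈
    ... | inj₂ vc = true≢false (trans (sym vc) (child-unvisited c co))

    hanging-child : ∀ {h b} → h ∈ ws → Anc parT h b → b ∉ ws → Σ Vtx λ c → ChildOff ws c × Anc parT c b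
    hanging-child h∈ anc-refl b∉ = ⊥-elim (b∉ h∈)
    hanging-child h∈ (anc-step {y = b} {z = z} e hz) b∉ with z ∈? ws
    ... | yes z∈ = b , (z , z∈ , e , λ nx → b∉ (NextOn-∈ʳ nx)) , anc-refl
    ... | no z∉ with hanging-child h∈ hz z∉
    ...   | c , co , cz = c , co , anc-step e cz

    marked-ps-old : ∀ v → Visited σ v → ps σm v ≡ ps σ v
    marked-ps-old v vv = setPath-∉ ws (ps σ) v (old∉path v vv)

    marked-ascends : Ascends (ps σm) ws x
    marked-ascends = setPath-ascends ws (ps σ) unique ends-at

    marked-ps-x : ps σm x ≡ g
    marked-ps-x = trans (setPath-last ws (ps σ) unique ends-at) ps-x

    marked-ps-root : ∀ g' → Attached g' x σ → ps σm x ≡ g' → ps σm root ≡ nothing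
    marked-ps-root g' att e with root ∈? ws
    marked-ps-root g' att e | no r∉ = trans (setPath-∉ ws (ps σ) root r∉) (Invariant.ps-root I)
    marked-ps-root nothing x≡r e | yes r∈ = subst (λ r → ps σm r ≡ nothing) x≡r e
    marked-ps-root (just w) (vw , _) e | yes r∈ = ⊥-elim (old∉path root (root-visited I w vw) r∈)

    marked-x-edge : ∀ g' → Attached g' x σ → ps σm x ≡ g' → x ≢ root →
                    Σ Vtx λ u → ps σm x ≡ just u × Visited σm u × Adj u x
    marked-x-edge nothing x≡r e x≢r = ⊥-elim (x≢r x≡r)
    marked-x-edge (just w) (vw , wx) e x≢r = w , e , markAll-old ws (vis σ) w vw , wx

    marked-x-spanning : ∀ g' → Attached g' x σ → ps σm x ≡ g' → Anc (ps σm) root x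
    marked-x-spanning nothing x≡r e = subst (Anc (ps σm) root) (sym x≡r) anc-refl
    marked-x-spanning (just w) (vw , _) e = anc-step e (Anc-keep I σm marked-ps-old (Invariant.ps-spanning I w vw) vw)

    marked-active : ∀ g' → Attached g' x σ → ∀ a → AncM (ps σ) g' a → AncM (ps σm) g' a
    marked-active (just w) (vw , _) a aw = Anc-keep I σm marked-ps-old aw vw

    marked-invariant : Invariant σm (headOrM ws g)
    marked-invariant = record
      { parT-closed = closed
      ; ps-root = marked-ps-root g attached marked-ps-x
      ; ps-edge = edge
      ; ps-spanning = spans
      ; finished = fin
      ; L-initial = λ a b m → L-sub a b (Invariant.L-initial I a b m)
      ; L-edges = L₁-edges }
      where
      closed : ∀ y z → Visited σm y → parT y ≡ just z → Visited σm z
      closed y z vy e with markAll⁻ ws (vis σ) y vy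
      ... | inj₂ old = markAll-old ws (vis σ) z (Invariant.parT-closed I y z old e)
      ... | inj₁ y∈ = [ markAll-∈ ws (vis σ) z , markAll-old ws (vis σ) z ]′
                        (Descends-parent-closed parT (vis σ) ws stops descends y∈ e)
      edge : ∀ v → Visited σm v → v ≢ root → Σ Vtx λ u → ps σm v ≡ just u × Visited σm u × Adj u v
      edge v vv v≢r with markAll⁻ ws (vis σ) v vv
      ... | inj₂ old = let (u , e , vu , ad) = Invariant.ps-edge I v old v≢r
                       in u , trans (marked-ps-old v old) e , markAll-old ws (vis σ) u vu , ad
      ... | inj₁ v∈ with v ≟ x
      ...   | yes refl = marked-x-edge g attached marked-ps-x v≢r
      ...   | no v≢x with path-successor ws marked-ascends descends v∈ v≢x
      ...     | v' , e , v'∈ , et =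
                v' , e , markAll-∈ ws (vis σ) v' v'∈ , AdjGU-sym EG EU v v' (inj₁ (parT-edge v' v et))
      spans : ∀ v → Visited σm v → Anc (ps σm) root v
      spans v vv with markAll⁻ ws (vis σ) v vv
      ... | inj₂ old = Anc-keep I σm marked-ps-old (Invariant.ps-spanning I v old) old
      ... | inj₁ v∈ = Anc-trans (ps σm) (marked-x-spanning g attached marked-ps-x)
                                (Ascends-Anc-end (ps σm) ws marked-ascends v∈)
      fin : ∀ a b → Visited σm a → ¬ AncM (ps σm) (headOrM ws g) a → Adj a b →
            Visited σm b × (Anc (ps σm) a b ⊎ Anc (ps σm) b a)
      fin a b va ¬act ab with markAll⁻ ws (vis σ) a va
      ... | inj₁ a∈ = ⊥-elim (¬act (proj₁ (path-active ws marked-ascends marked-ps-x) a a∈))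
      ... | inj₂ old with Invariant.finished I a b old
                            (λ act → ¬act (proj₂ (path-active ws marked-ascends marked-ps-x) a (marked-active g attached a act))) ab
      ...   | vb , inj₁ a≤b = markAll-old ws (vis σ) b vb , inj₁ (Anc-keep I σm marked-ps-old a≤b vb)
      ...   | vb , inj₂ b≤a = markAll-old ws (vis σ) b vb , inj₂ (Anc-keep I σm marked-ps-old b≤a old)

    start : PathInvariant ws σm
    start = record
      { invariant = marked-invariant
      ; vis-mono = markAll-old ws (vis σ)
      ; path-visited = markAll-∈ ws (vis σ)
      ; ps-stable = marked-ps-old
      ; ascends = marked-ascends
      ; ps-x-kept = marked-ps-x
      ; rest-descends = descends
      ; suffix = λ y m → m
      ; new-vertices = new
      ; L-mono = λ a b m → m }
      where
      new : ∀ v → Visited σm v → vis σ v ≡ false → v ∈ ws ⊎ Anc (ps σm) (headOr ws x) v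
      new v vv f with markAll⁻ ws (vis σ) v vv
      ... | inj₁ v∈ = inj₁ v∈
      ... | inj₂ old = ⊥-elim (true≢false (trans (sym old) f))

    stop : ∀ {σ'} → PathInvariant [] σ' → RunSpec x g σ σ'
    stop {σ'} j = record
      { invariant = invariant
      ; vis-mono = vis-mono
      ; ps-stable = ps-stable
      ; ps-x = trans ps-x-kept (sym ps-x)
      ; new-below = λ v vv f → [ (λ ()) , (λ a → a) ]′ (new-vertices v vv f)
      ; L-mono = λ a b m → L-mono a b (L-sub a b m)
      ; x-visited = path-visited x (last-∈ ws ends-at) }
      where open PathInvariant j

    module FinishVertex {h : Vtx} {rest : List Vtx} {σa σ₁ : State n} {xs : List Vtx}
                        (j : PathInvariant (h ∷ rest) σa) (perm : xs ↭ L σa h) (Q : NbrsSpec h xs σa σ₁) where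
      module j = PathInvariant j
      module Q = NbrsSpec Q
      I₁ = Q.invariant

      h∈ : h ∈ ws
      h∈ = j.suffix h (here refl)

      h-visited : Visited σa h
      h-visited = j.path-visited h h∈

      ps-stable₁ : ∀ v → Visited σ v → ps σ₁ v ≡ ps σ v
      ps-stable₁ v vv = trans (Q.ps-stable v (j.vis-mono v vv)) (j.ps-stable v vv)

      ascends₁ : Ascends (ps σ₁) (h ∷ rest) x
      ascends₁ = Ascends-agree (ps σa) (ps σ₁) (h ∷ rest)
                   (λ y m → Q.ps-stable y (j.path-visited y (j.suffix y m))) j.ascends

      ps-x₁ : ps σ₁ x ≡ g
      ps-x₁ = trans (Q.ps-stable x (j.path-visited x (last-∈ ws ends-at))) j.ps-x-kept

      keep₁ : ∀ {a b} → Anc (ps σa) a b → Visited σa b → Anc (ps σ₁) a b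
      keep₁ = Anc-keep j.invariant σ₁ Q.ps-stable

      next-below-h : Anc (ps σ₁) (headOr rest x) h
      next-below-h = Ascends-Anc-next (ps σ₁) h rest ascends₁

      -- An old neighbour of h is finished unless it is active, and an old active vertex lies above h.
      old-nbr-above : ∀ g' → Invariant σ g' → Attached g' x σ → ps σ₁ x ≡ g' →
                      ∀ b → Visited σ b → Adj h b → Anc (ps σ₁) b h
      old-nbr-above nothing I' _ e b vb hb =
        ⊥-elim (old∉path h (proj₁ (Invariant.finished I' b h vb (λ ()) (AdjGU-sym EG EU h b hb))) h∈)
      old-nbr-above (just w) I' (vw , _) e b vb hb with Anc-ps-dec I' vw b
      ... | yes bw = Anc-trans (ps σ₁) (anc-step e (Anc-keep I' σ₁ ps-stable₁ bw vw))
                       (Ascends-Anc-end (ps σ₁) (h ∷ rest) ascends₁ (here refl))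
      ... | no ¬bw = ⊥-elim (old∉path h (proj₁ (Invariant.finished I' b h vb ¬bw (AdjGU-sym EG EU h b hb))) h∈)

      nbr-comparable : ∀ b → Visited σ₁ b → Adj h b → Anc (ps σ₁) h b ⊎ Anc (ps σ₁) b h
      nbr-comparable b vb hb with true⊎false (vis σ b)
      ... | inj₁ old = inj₂ (old-nbr-above g I attached ps-x₁ b old hb)
      ... | inj₂ f with true⊎false (vis σa b)
      ...   | inj₂ fa = inj₁ (Q.new-below b vb fa)
      ...   | inj₁ ta with j.new-vertices b ta f
      ...     | inj₁ (here refl) = inj₁ anc-refl
      ...     | inj₁ (there m) = inj₂ (keep₁ (Ascends-Anc-head (ps σa) h rest j.ascends m) h-visited)
      ...     | inj₂ a = inj₁ (keep₁ a ta)

      -- Vertices of a subtree hanging off the path are visited only below h, hence are finished.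
      subtree-inactive : ∀ c → ChildOff ws c → ∀ v → Anc parT c v → Visited σ₁ v → ¬ Anc (ps σ₁) v h
      subtree-inactive c co v cv vv vh = v∉ (subst (_∈ ws) (sym (ps-antisym I₁ vv vh h≤v)) h∈)
        where
        v∉ : v ∉ ws
        v∉ = subtree∉path co cv
        v-new : vis σ v ≡ false
        v-new with true⊎false (vis σ v)
        ... | inj₂ f = f
        ... | inj₁ t = ⊥-elim (true≢false (trans (sym (Anc-closed parT (Visited σ) (Invariant.parT-closed I) cv t))
                                                  (child-unvisited c co)))
        h≤v : Anc (ps σ₁) h v
        h≤v with true⊎false (vis σa v)
        ... | inj₂ f = Q.new-below v vv f
        ... | inj₁ t with j.new-vertices v t v-new
        ...   | inj₁ m = ⊥-elim (v∉ (j.suffix v m))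
        ...   | inj₂ a = keep₁ a t

      subtree-visited : ∀ c → ChildOff ws c → Visited σ₁ c → ∀ v → Anc parT c v → Visited σ₁ v
      subtree-visited c co vc v anc-refl = vc
      subtree-visited c co vc v (anc-step {z = z} e cz) =
        proj₁ (Invariant.finished I₁ z v vz (subtree-inactive c co z cz vz) (inj₁ (parT-edge v z e)))
        where
        vz = subtree-visited c co vc z cz

      query-target-visited : ∀ y z → y ∈ ws → Anc parT y h → AdjG EG y z → z ∈ L₁ y → Visited σ₁ z
      query-target-visited y z y∈ yh yz zL with y ∈? (h ∷ rest)
      ... | yes y∈′ =
            Q.all-visited z (∈-resp-↭ (↭-sym perm) (j.L-mono h z (subst (λ w → z ∈ L₁ w) (y≡h y∈′) zL)))
        where
        y≡h : y ∈ h ∷ rest → y ≡ h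
        y≡h (here e) = e
        y≡h (there m) = parT-antisym yh (Descends-Anc parT h rest j.rest-descends m)
      ... | no y∉ with j.new-vertices y (j.path-visited y y∈) (unmarked y y∈)
      ...   | inj₁ m = ⊥-elim (y∉ m)
      ...   | inj₂ hy = Q.vis-mono z (proj₁ (Invariant.finished j.invariant y z (j.path-visited y y∈)
                          (λ yh' → y∉ (here (ps-antisym j.invariant (j.path-visited y y∈) yh' hy))) (inj₁ yz)))

      nbr-visited : ∀ b → Adj h b → Visited σ₁ b
      nbr-visited b (inj₂ hb) =
        Q.all-visited b (∈-resp-↭ (↭-sym perm)
          (Invariant.L-initial j.invariant h b (addEdges-edge (λ _ → []) EU h b hb)))
      nbr-visited b (inj₁ hb) with parT-back-edges h b hb
      ... | inj₂ b≤h = [ (λ b∈ → Q.vis-mono b (j.path-visited b b∈)) , (λ old → Q.vis-mono b (j.vis-mono b old)) ]′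
                         (Descends-Anc-closed parT (vis σ) (Invariant.parT-closed I) ws stops descends h∈ b≤h)
      ... | inj₁ h≤b with true⊎false (vis σ₁ b)
      ...   | inj₁ t = t
      ...   | inj₂ f with hanging-child h∈ h≤b (λ m → true≢false (trans (sym (Q.vis-mono b (j.path-visited b m))) f))
      ...     | c , co , cb with results c (cs-complete c co)
      ...       | inj₁ qn = ⊥-elim (qn h b h∈ cb hb)
      ...       | inj₂ (y , z , (y∈ , cz , yz , highest) , zL) =
                  subtree-visited c co
                    (Anc-closed parT (Visited σ₁) (Invariant.parT-closed I₁) cz
                      (query-target-visited y z y∈ (highest h b h∈ cb hb) yz zL)) b cb

      finished-next : ∀ a b → Visited σ₁ a → ¬ AncM (ps σ₁) (headOrM rest g) a → Adj a b →
                      Visited σ₁ b × (Anc (ps σ₁) a b ⊎ Anc (ps σ₁) b a)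
      finished-next a b va ¬act ab with a ≟ h
      ... | yes refl = nbr-visited b ab , nbr-comparable b (nbr-visited b ab) ab
      ... | no a≢h = Invariant.finished I₁ a b va ¬ah ab
        where
        ¬ah : ¬ Anc (ps σ₁) a h
        ¬ah ah with Anc-split (ps σ₁) ah
        ... | inj₁ a≡h = a≢h a≡h
        ... | inj₂ act = ¬act (subst (λ m → AncM (ps σ₁) m a) (Ascends-next (ps σ₁) h rest ascends₁ ps-x₁) act)

      new-vertices-next : ∀ v → Visited σ₁ v → vis σ v ≡ false → v ∈ rest ⊎ Anc (ps σ₁) (headOr rest x) v
      new-vertices-next v vv f with true⊎false (vis σa v)
      ... | inj₂ fa = inj₂ (Anc-trans (ps σ₁) next-below-h (Q.new-below v vv fa))
      ... | inj₁ ta with j.new-vertices v ta f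
      ...   | inj₁ (here refl) = inj₂ next-below-h
      ...   | inj₁ (there m) = inj₁ m
      ...   | inj₂ a = inj₂ (Anc-trans (ps σ₁) next-below-h (keep₁ a ta))

      next : PathInvariant rest σ₁
      next = record
        { invariant = record
          { parT-closed = Invariant.parT-closed I₁
          ; ps-root = Invariant.ps-root I₁
          ; ps-edge = Invariant.ps-edge I₁
          ; ps-spanning = Invariant.ps-spanning I₁
          ; finished = finished-next
          ; L-initial = Invariant.L-initial I₁
          ; L-edges = Invariant.L-edges I₁ }
        ; vis-mono = λ v vv → Q.vis-mono v (j.vis-mono v vv)
        ; path-visited = λ v m → Q.vis-mono v (j.path-visited v m)
        ; ps-stable = ps-stable₁
        ; ascends = Ascends-tail (ps σ₁) h rest ascends₁
        ; ps-x-kept = ps-x₁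
        ; rest-descends = Descends-tail parT h rest j.rest-descends
        ; suffix = λ y m → j.suffix y (there m)
        ; new-vertices = new-vertices-next
        ; L-mono = λ a b m → Q.L-mono a b (j.L-mono a b m) }

  mutual
    run-spec : ∀ {x σ σ'} g → Run x σ σ' → Invariant σ g → vis σ x ≡ false → ps σ x ≡ g →
               Attached g x σ → RunSpec x g σ σ'
    run-spec {x} {σ} g (run ws cs up _ _ cs-complete qs ip) I vx psx att =
      PathLoop.stop C (path-loop C ws ip (PathLoop.start C))
      where
      C : RunContext
      C = record { x = x ; g = g ; σ = σ ; ws = ws ; cs = cs ; L₁ = _ ; I = I ; attached = att ; ps-x = psx
                 ; climb = upPath-facts up ; cs-complete = cs-complete ; results = queries-result qs
                 ; L-sub = queries-L-mono qs ; L₁-edges = queries-edges qs (Invariant.L-edges I) }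

    path-loop : (C : RunContext) → ∀ ws' {σa σb} → IterPath ws' σa σb →
                PathLoop.PathInvariant C ws' σa → PathLoop.PathInvariant C [] σb
    path-loop C [] ip-done j = j
    path-loop C (h ∷ rest) (ip-next xs perm nbrs ip) j =
      path-loop C rest ip (PathLoop.FinishVertex.next C j perm
        (nbrs-spec nbrs invariant (path-visited h (suffix h (here refl)))
                   (λ y m → Invariant.L-edges invariant h y (∈-resp-↭ perm m))))
      where open PathLoop.PathInvariant j

    nbrs-spec : ∀ {h xs σ σ'} → IterNbrs h xs σ σ' → Invariant σ (just h) → Visited σ h →
                (∀ y → y ∈ xs → Adj h y) → NbrsSpec h xs σ σ'
    nbrs-spec in-done I vh adj = record
      { invariant = I ; vis-mono = λ v vv → vv ; ps-stable = λ v vv → refl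
      ; new-below = λ v vv f → ⊥-elim (true≢false (trans (sym vv) f))
      ; L-mono = λ a b m → m ; all-visited = λ y () }
    nbrs-spec (in-skip vx rs) I vh adj = record
      { invariant = invariant ; vis-mono = vis-mono ; ps-stable = ps-stable ; new-below = new-below
      ; L-mono = L-mono
      ; all-visited = λ { y (here refl) → vis-mono y vx ; y (there m) → all-visited y m } }
      where open NbrsSpec (nbrs-spec rs I vh (λ y m → adj y (there m)))
    nbrs-spec {h} {x ∷ xs} {σ} {σ₂} (in-visit {σ₁ = σ₁} vx r rs) I vh adj = record
      { invariant = R.invariant
      ; vis-mono = λ v vv → R.vis-mono v (P.vis-mono v vv)
      ; ps-stable = λ v vv → trans (R.ps-stable v (P.vis-mono v vv)) (trans (P.ps-stable v vv) (attach-old {σ} h vx v vv))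
      ; new-below = new-below
      ; L-mono = λ a b m → R.L-mono a b (P.L-mono a b m)
      ; all-visited = λ { y (here refl) → R.vis-mono y P.x-visited ; y (there m) → R.all-visited y m } }
      where
      P = run-spec (just h) r (invariant-attach I vh vx) vx (upd-same (ps σ) x (just h)) (vh , adj x (here refl))
      module P = RunSpec P
      R = nbrs-spec rs P.invariant (P.vis-mono h vh) (λ y m → adj y (there m))
      module R = NbrsSpec R
      ps-x₂ : ps σ₂ x ≡ just h
      ps-x₂ = trans (R.ps-stable x P.x-visited) (trans P.ps-x (upd-same (ps σ) x (just h)))
      new-below : ∀ v → Visited σ₂ v → vis σ v ≡ false → Anc (ps σ₂) h v
      new-below v vv f with true⊎false (vis σ₁ v)
      ... | inj₂ f₁ = R.new-below v vv f₁
      ... | inj₁ t₁ = Anc-trans (ps σ₂) (anc-step ps-x₂ anc-refl)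
                        (Anc-keep P.invariant σ₂ R.ps-stable (P.new-below v t₁ f) t₁)

  initial-invariant : Invariant σ₀ nothing
  initial-invariant = record
    { parT-closed = λ y z ()
    ; ps-root = refl
    ; ps-edge = λ v ()
    ; ps-spanning = λ v ()
    ; finished = λ a b ()
    ; L-initial = λ a b m → m
    ; L-edges = addEdges⁻ Adj (λ _ → []) EU (λ a b ()) (λ a b e → inj₂ e) }

  run-yields-DFS-tree : ∀ σ → Run root σ₀ σ → IsDFSTree (λ _ → ⊤) Adj (ps σ)
  run-yields-DFS-tree σ r = record
    { root-in = tt
    ; root-par = Invariant.ps-root I
    ; tree-edge = λ v _ v≢r → let (u , e , _ , uv) = Invariant.ps-edge I v (all-visited v) v≢r in u , e , tt , uv
    ; spanning = λ v _ → Invariant.ps-spanning I v (all-visited v)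
    ; back-edges = λ a b _ _ ab → proj₂ (Invariant.finished I a b (all-visited a) (λ ()) ab) }
    where
    P = run-spec nothing r initial-invariant refl refl refl
    I = RunSpec.invariant P
    -- Every vertex is a neighbour of the super root, which is finished.
    all-visited : ∀ v → Visited σ v
    all-visited v = proj₁ (Invariant.finished I root v (RunSpec.x-visited P) (λ ()) (inj₁ (inj₂ (inj₁ refl))))

  AdjG? : ∀ y z → Dec (AdjG EG y z)
  AdjG? y z = ((y , z) ∈E? EG ⊎-dec (z , y) ∈E? EG) ⊎-dec (y ≟ root ⊎-dec z ≟ root)
    where
    open import Data.List.Membership.DecPropositional (≡-dec (_≟_ {suc n}) (_≟_ {suc n}))
      renaming (_∈?_ to _∈E?_)

  InSub? : ∀ c z → Dec (InSub c z)
  InSub? c z = Anc-dec parT parT-root (parT-spanning z) c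

  NextOn? : ∀ (ws : List Vtx) w x → Dec (NextOn ws w x)
  NextOn? [] w x = no λ ()
  NextOn? (a ∷ []) w x = no λ { (there ()) }
  NextOn? (a ∷ b ∷ ws) w x with NextOn? (b ∷ ws) w x | w ≟ a | x ≟ b
  ... | yes nx | _ | _ = yes (there nx)
  ... | no _ | yes refl | yes refl = yes here
  ... | no ¬nx | no w≢a | _ = no λ { here → w≢a refl ; (there nx) → ¬nx nx }
  ... | no ¬nx | yes _ | no x≢b = no λ { here → x≢b refl ; (there nx) → ¬nx nx }

  ChildOff? : ∀ ws c → Dec (ChildOff ws c)
  ChildOff? ws c with parT c in eq
  ... | nothing = no λ { (w , _ , e , _) → nothing≢just e }
  ... | just w with w ∈? ws | NextOn? ws w c
  ...   | no w∉ | _ = no λ { (w' , w'∈ , e , _) → w∉ (subst (_∈ ws) (sym (just-injective e)) w'∈) }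
  ...   | yes w∈ | no ¬nx = yes (w , w∈ , refl , ¬nx)
  ...   | yes w∈ | yes nx = no λ { (w' , _ , e , ¬nx) → ¬nx (subst (λ u → NextOn ws u c) (just-injective e) nx) }

  -- Scanning the path from its top finds the highest vertex adjacent to T(c), which answers Q(T(c), u, v).
  highest-hit : ∀ c ws → Descends parT ws → QNull ws c ⊎ ∃₂ (QHit ws c)
  highest-hit c [] d = inj₁ λ y z ()
  highest-hit c (a ∷ ws) d with any? (λ z → InSub? c z ×-dec AdjG? a z)
  ... | yes (z , cz , az) = inj₂ (a , z , here refl , cz , az , highest)
    where
    highest : ∀ y' z' → y' ∈ a ∷ ws → InSub c z' → AdjG EG y' z' → Anc parT a y'
    highest y' z' (here refl) _ _ = anc-refl
    highest y' z' (there m) _ _ = Descends-Anc parT a ws d m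
  ... | no none with highest-hit c ws (Descends-tail parT a ws d)
  ...   | inj₁ null = inj₁ λ { y z (here refl) cz az → none (z , cz , az) ; y z (there m) → null y z m }
  ...   | inj₂ (y , z , y∈ , cz , yz , highest) = inj₂ (y , z , there y∈ , cz , yz , highest′)
    where
    highest′ : ∀ y' z' → y' ∈ a ∷ ws → InSub c z' → AdjG EG y' z' → Anc parT y y'
    highest′ y' z' (here refl) cz' az' = ⊥-elim (none (z' , cz' , az'))
    highest′ y' z' (there m) = highest y' z' m

  queries-exist : ∀ ws → Descends parT ws → ∀ cs L → Σ (Vtx → List Vtx) λ L' → Queries ws cs L L'
  queries-exist ws d [] L = L , q-done
  queries-exist ws d (c ∷ cs) L with highest-hit c ws d
  ... | inj₁ null = let (L' , q) = queries-exist ws d cs L in L' , q-null null q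
  ... | inj₂ (y , z , hit) = let (L' , q) = queries-exist ws d cs (addL y z L) in L' , q-hit y z hit q

  climb : ∀ (f : Vtx → Bool) x → Anc parT root x → f x ≡ false → Σ (List Vtx) λ ws → UpPath f x ws
  climb f x anc-refl fx = [ x ] , top fx (inj₁ parT-root)
  climb f x (anc-step {z = z} e rz) fx with true⊎false (f z)
  ... | inj₁ t = [ x ] , top fx (inj₂ (z , e , t))
  ... | inj₂ fz = let (ws , up) = climb f z rz fz in ws ++ [ x ] , down up e fx

  unvisited : (Vtx → Bool) → ℕ
  unvisited f = unmarkedCount f (allFin (suc n))

  record Prepared (σ : State n) (x : Vtx) : Set where
    field
      ws : List Vtx
      cs : List Vtx
      L₁ : Vtx → List Vtx
      up : UpPath (vis σ) x ws
      cs-unique : Unique cs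
      cs-sound : ∀ c → c ∈ cs → ChildOff ws c
      cs-complete : ∀ c → ChildOff ws c → c ∈ cs
      queries : Queries ws cs (L σ) L₁
      decreases : unvisited (markAll ws (vis σ)) < unvisited (vis σ)

  prepare : ∀ σ x → vis σ x ≡ false → Prepared σ x
  prepare σ x vx = record
    { ws = ws ; cs = cs ; L₁ = proj₁ Q ; up = up
    ; cs-unique = filter⁺ (ChildOff? ws) (allFin⁺ (suc n))
    ; cs-sound = λ c m → proj₂ (∈-filter⁻ (ChildOff? ws) m)
    ; cs-complete = λ c co → ∈-filter⁺ (ChildOff? ws) (∈-allFin c) co
    ; queries = proj₂ Q
    ; decreases = unmarkedCount-strict (vis σ) (markAll ws (vis σ)) (markAll-old ws (vis σ)) (∈-allFin x) vx
                    (markAll-∈ ws (vis σ) x (last-∈ ws (ClimbFacts.ends-at (upPath-facts up)))) }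
    where
    U = climb (vis σ) x (parT-spanning x) vx
    ws = proj₁ U
    up = proj₂ U
    cs = filter (ChildOff? ws) (allFin (suc n))
    Q = queries-exist ws (ClimbFacts.descends (upPath-facts up)) cs (L σ)

  Grows : State n → State n → Set
  Grows σ σ' = ∀ v → vis σ v ≡ true → vis σ' v ≡ true

  grows-fuel : ∀ {σ σ' k} → Grows σ σ' → unvisited (vis σ) ≤ k → unvisited (vis σ') ≤ k
  grows-fuel {σ} {σ'} gr = ≤-trans (unmarkedCount-mono (vis σ) (vis σ') gr (allFin (suc n)))

  -- The fuel k bounds the number of unvisited vertices, which every call to DFS decreases.
  mutual
    run-exists : ∀ k σ x → unvisited (vis σ) ≤ k → vis σ x ≡ false →
                 Σ (State n) λ σ' → Run x σ σ' × Grows σ σ'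
    run-exists zero σ x k≥ vx = ⊥-elim (n≮0 (<-≤-trans (Prepared.decreases (prepare σ x vx)) k≥))
    run-exists (suc k) σ x k≥ vx with path-exists k ws _ (≤-pred (<-≤-trans decreases k≥))
      where open Prepared (prepare σ x vx)
    ... | σ' , ip , gr = σ' , run ws cs up cs-unique cs-sound cs-complete queries ip
                             , λ v t → gr v (markAll-old ws (vis σ) v t)
      where open Prepared (prepare σ x vx)

    path-exists : ∀ k ws σ → unvisited (vis σ) ≤ k → Σ (State n) λ σ' → IterPath ws σ σ' × Grows σ σ'
    path-exists k [] σ k≥ = σ , ip-done , λ v t → t
    path-exists k (w ∷ ws) σ k≥ with nbrs-exist k w (L σ w) σ k≥
    ... | σ₁ , nbrs , gr₁ with path-exists k ws σ₁ (grows-fuel {σ} {σ₁} gr₁ k≥)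
    ...   | σ₂ , ip , gr₂ = σ₂ , ip-next (L σ w) ↭-refl nbrs ip , λ v t → gr₂ v (gr₁ v t)

    nbrs-exist : ∀ k w xs σ → unvisited (vis σ) ≤ k → Σ (State n) λ σ' → IterNbrs w xs σ σ' × Grows σ σ'
    nbrs-exist k w [] σ k≥ = σ , in-done , λ v t → t
    nbrs-exist k w (x ∷ xs) σ k≥ with true⊎false (vis σ x)
    ... | inj₁ t = let (σ' , rs , gr) = nbrs-exist k w xs σ k≥ in σ' , in-skip t rs , gr
    ... | inj₂ f with run-exists k (attach σ x w) x k≥ f
    ...   | σ₁ , r , gr₁ with nbrs-exist k w xs σ₁ (grows-fuel {σ} {σ₁} gr₁ k≥)
    ...     | σ₂ , rs , gr₂ = σ₂ , in-visit f r rs , λ v t → gr₂ v (gr₁ v t)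

  run-exists-from-root : Σ (State n) λ σ → Run root σ₀ σ
  run-exists-from-root = let (σ , r , _) = run-exists (unvisited (vis σ₀)) σ₀ root ≤-refl refl in σ , r

theorem6 : ∀ {n : ℕ} (VG : V n → Bool) (EG : List (V n × V n))
             (par : V n → Maybe (V n)) (EU : List (V n × V n)) →
           (∀ x y → (x , y) ∈ EG → T (VG x) × T (VG y)) →
           IsDFSTree (λ v → T (VG v)) (AdjG EG) par →
           (Σ (State n) λ σ → Alg.Run VG EG par EU root (Alg.σ₀ VG EG par EU) σ)
           × (∀ σ → Alg.Run VG EG par EU root (Alg.σ₀ VG EG par EU) σ →
                IsDFSTree (λ _ → ⊤) (AdjGU EG EU) (ps σ))
theorem6 VG EG par EU G-edges dfsT = run-exists-from-root , run-yields-DFS-tree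
  where open BatchInsertProof VG EG par EU G-edges dfsT
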